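{- Let $G$ be a finite simple graph, and suppose the automorphism group $\mathrm{Aut}(G)$ contains an element $\sigma$ of order $2$ such that for every $v\in V(G)$ we have $\sigma(v)\ne v$ and $v$ is not adjacent to $\sigma(v)$. Then $G$ is a $\mathcal{P}$ position of Grim.
   Context: Grim: two players alternate moves on a finite simple undirected graph. Before play, isolated vertices are deleted. A move consists of choosing a remaining vertex and deleting it together with its incident edges, and then deleting every vertex that has become isolated. The player making the last move wins (a player with no available move loses). A graph is an $\mathcal{N}$ position if the player about to move has a winning strategy, and a $\mathcal{P}$ position otherwise. An automorphism of $G$ is a permutation of $V(G)$ preserving adjacency. -}

module Defs where

open import Data.Nat using (ℕ)
open import Data.Fin using (Fin; _≟_)
open import Data.Fin.Properties using (any?)
open import Data.Fin.Permutation using (Permutation′; _⟨$⟩ʳ_)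
open import Data.Bool using (Bool; true; false; _∧_; not; T)
open import Data.Bool.Properties using (T?)
open import Data.Product using (_×_; ∃)
open import Relation.Nullary using (¬_; Dec)
open import Relation.Nullary.Decidable using (⌊_⌋; _×-dec_)
open import Relation.Binary using (Decidable)
open import Relation.Binary.PropositionalEquality using (_≡_)
open import Function using (_⇔_)

record Graph (n : ℕ) : Set₁ where
  field
    Adj    : Fin n → Fin n → Set
    adj?   : Decidable Adj
    sym    : ∀ {u v} → Adj u v → Adj v u
    irrefl : ∀ {v} → ¬ Adj v v

-- Sets of remaining vertices.
VSet : ℕ → Set
VSet n = Fin n → Bool

module Grim {n : ℕ} (G : Graph n) where
  open Graph G

  hasNeighbour : VSet n → Fin n → Bool
  hasNeighbour S v = ⌊ any? (λ u → T? (S u) ×-dec adj? v u) ⌋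

  removeIsolated : VSet n → VSet n
  removeIsolated S v = S v ∧ hasNeighbour S v

  move : VSet n → Fin n → VSet n
  move S v = removeIsolated (λ u → S u ∧ not ⌊ u ≟ v ⌋)

  start : VSet n
  start = removeIsolated (λ _ → true)

  -- Normal play: N = player to move wins, P = player to move loses.
  -- Inductive (well-founded) since the game is finite.
  mutual
    data NPos (S : VSet n) : Set where
      winningMove : (v : Fin n) → T (S v) → PPos (move S v) → NPos S

    data PPos (S : VSet n) : Set where
      allMovesLose : ((v : Fin n) → T (S v) → NPos (move S v)) → PPos S

  IsP : Set
  IsP = PPos start

IsAutomorphism : ∀ {n} → Graph n → Permutation′ n → Set
IsAutomorphism G σ = ∀ u v → Adj u v ⇔ Adj (σ ⟨$⟩ʳ u) (σ ⟨$⟩ʳ v)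
  where open Graph G

HasOrderTwo : ∀ {n} → Permutation′ n → Set
HasOrderTwo σ = (∀ v → σ ⟨$⟩ʳ (σ ⟨$⟩ʳ v) ≡ v) × ¬ (∀ v → σ ⟨$⟩ʳ v ≡ v)

-- Mirror strategy: answer every move v by σ v.  In a σ-invariant position
-- without isolated vertices, σ v survives the move v, because it has a
-- neighbour and that neighbour is not v.  Clearing isolated vertices between
-- two moves changes nothing, so the pair of moves deletes v and σ v and then
-- the isolated vertices, which keeps the position σ-invariant since σ is an
-- involutive automorphism.  The start position is σ-invariant, so the second
-- player always has a reply.
module Submission where

open import Defs
open import Data.Nat using (ℕ)
open import Data.Fin using (Fin; _≟_)
open import Data.Fin.Permutation using (Permutation′; _⟨$⟩ʳ_)
import Data.Fin.Subset as Subset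
import Data.Fin.Subset.Induction as SubsetInduction
open import Data.Bool using (true; false; _∧_; not; T)
open import Data.Bool.Properties using (T-≡; T-∧)
open import Data.Vec using (tabulate)
open import Data.Vec.Properties using ([]=↔lookup; lookup∘tabulate)
open import Data.Empty using (⊥-elim)
open import Data.Product using (_×_; _,_; proj₁; proj₂; ∃)
open import Function using (_⇔_; mk⇔; Equivalence; Inverse)
open import Induction.WellFounded using (WellFounded; Acc; acc; module Subrelation)
open import Relation.Binary.Construct.On as On using ()
open import Relation.Nullary using (¬_)
open import Relation.Nullary.Decidable using (⌊_⌋; toWitness; fromWitness; toWitnessFalse; fromWitnessFalse)
open import Relation.Binary.PropositionalEquality
  using (_≡_; _≢_; _≗_; refl; sym; trans; cong; subst)

open Equivalence using (to; from)

T-injective : ∀ {a b} → (T a ⇔ T b) → a ≡ b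
T-injective {false} {false} _ = refl
T-injective {false} {true}  e = ⊥-elim (from e _)
T-injective {true}  {false} e = ⊥-elim (to e _)
T-injective {true}  {true}  _ = refl

module _ {n : ℕ} where

  infix 4 _∈_ _∉_ _⊆_ _⊂_

  _∈_ : Fin n → VSet n → Set
  u ∈ S = T (S u)

  _∉_ : Fin n → VSet n → Set
  u ∉ S = ¬ u ∈ S

  _⊆_ : VSet n → VSet n → Set
  A ⊆ B = ∀ {u} → u ∈ A → u ∈ B

  _⊂_ : VSet n → VSet n → Set
  A ⊂ B = A ⊆ B × ∃ λ u → u ∈ B × u ∉ A

  ≗-from-∈ : ∀ {A B} → (∀ u → u ∈ A ⇔ u ∈ B) → A ≗ B
  ≗-from-∈ e u = T-injective (e u)

  ∈-tabulate : ∀ {A u} → u ∈ A ⇔ u Subset.∈ tabulate A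
  ∈-tabulate {A} {u} = mk⇔
    (λ u∈A → Inverse.from []=↔lookup (trans (lookup∘tabulate A u) (to T-≡ u∈A)))
    (λ u∈A → from T-≡ (trans (sym (lookup∘tabulate A u)) (Inverse.to []=↔lookup u∈A)))

  ⊆-⊂-trans : ∀ {A B C} → A ⊆ B → B ⊂ C → A ⊂ C
  ⊆-⊂-trans A⊆B (B⊆C , u , u∈C , u∉B) = (λ x∈A → B⊆C (A⊆B x∈A)) , u , u∈C , λ u∈A → u∉B (A⊆B u∈A)

  ⊂⇒tabulate-⊂ : ∀ {A B} → A ⊂ B → tabulate A Subset.⊂ tabulate B
  ⊂⇒tabulate-⊂ (A⊆B , u , u∈B , u∉A) =
    (λ x∈A → to ∈-tabulate (A⊆B (from ∈-tabulate x∈A))) ,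
    u , to ∈-tabulate u∈B , λ u∈A → u∉A (from ∈-tabulate u∈A)

  ⊂-wellFounded : WellFounded _⊂_
  ⊂-wellFounded =
    Subrelation.wellFounded ⊂⇒tabulate-⊂ (On.wellFounded tabulate SubsetInduction.⊂-wellFounded)

module GrimProperties {n : ℕ} (G : Graph n) where
  open Graph G renaming (sym to Adj-sym)
  open Grim G

  delete : VSet n → Fin n → VSet n
  delete S v u = S u ∧ not ⌊ u ≟ v ⌋

  ∈-delete : ∀ S v {u} → u ∈ delete S v ⇔ (u ∈ S × u ≢ v)
  ∈-delete S v = mk⇔
    (λ p → let u∈S , u≢v = to (T-∧ {S _}) p in u∈S , toWitnessFalse u≢v)
    (λ (u∈S , u≢v) → from (T-∧ {S _}) (u∈S , fromWitnessFalse u≢v))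

  ∈-removeIsolated : ∀ S {u} → u ∈ removeIsolated S ⇔ (u ∈ S × ∃ λ x → x ∈ S × Adj u x)
  ∈-removeIsolated S = mk⇔
    (λ p → let u∈S , nb = to (T-∧ {S _}) p in u∈S , toWitness nb)
    (λ (u∈S , nb) → from (T-∧ {S _}) (u∈S , fromWitness nb))

  removeIsolated-⊆ : ∀ S → removeIsolated S ⊆ S
  removeIsolated-⊆ S u∈ = proj₁ (to (∈-removeIsolated S) u∈)

  move-⊆-delete : ∀ S v → move S v ⊆ delete S v
  move-⊆-delete S v = removeIsolated-⊆ (delete S v)

  move-⊆ : ∀ S v → move S v ⊆ S
  move-⊆ S v u∈ = proj₁ (to (∈-delete S v) (move-⊆-delete S v u∈))

  move-⊂ : ∀ {S v} → v ∈ S → move S v ⊂ S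
  move-⊂ {S} {v} v∈S =
    move-⊆ S v , v , v∈S , λ v∈ → proj₂ (to (∈-delete S v) (move-⊆-delete S v v∈)) refl

  move-removeIsolated : ∀ S v → move (removeIsolated S) v ≗ move S v
  move-removeIsolated S v = ≗-from-∈ λ u → mk⇔ shrink grow
    where
    S′ = removeIsolated S

    shrink : ∀ {u} → u ∈ move S′ v → u ∈ move S v
    shrink u∈ =
      let u∈′ , x , x∈′ , u~x = to (∈-removeIsolated (delete S′ v)) u∈
          u∈S′ , u≢v = to (∈-delete S′ v) u∈′
          x∈S′ , x≢v = to (∈-delete S′ v) x∈′
      in from (∈-removeIsolated (delete S v))
           (from (∈-delete S v) (removeIsolated-⊆ S u∈S′ , u≢v) ,
            x , from (∈-delete S v) (removeIsolated-⊆ S x∈S′ , x≢v) , u~x)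

    grow : ∀ {u} → u ∈ move S v → u ∈ move S′ v
    grow {u} u∈ =
      let u∈′ , x , x∈′ , u~x = to (∈-removeIsolated (delete S v)) u∈
          u∈S , u≢v = to (∈-delete S v) u∈′
          x∈S , x≢v = to (∈-delete S v) x∈′
          u∈S′ = from (∈-removeIsolated S) (u∈S , x , x∈S , u~x)
          x∈S′ = from (∈-removeIsolated S) (x∈S , u , u∈S , Adj-sym u~x)
      in from (∈-removeIsolated (delete S′ v))
           (from (∈-delete S′ v) (u∈S′ , u≢v) , x , from (∈-delete S′ v) (x∈S′ , x≢v) , u~x)

  NoIsolated : VSet n → Set
  NoIsolated S = ∀ {u} → u ∈ S → ∃ λ x → x ∈ S × Adj u x

  removeIsolated-noIsolated : ∀ S → NoIsolated (removeIsolated S)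
  removeIsolated-noIsolated S u∈ =
    let u∈S , x , x∈S , u~x = to (∈-removeIsolated S) u∈
    in x , from (∈-removeIsolated S) (x∈S , _ , u∈S , Adj-sym u~x) , u~x

  module Mirror (σ : Fin n → Fin n)
                (σ-involutive : ∀ v → σ (σ v) ≡ v)
                (σ-adj : ∀ {u v} → Adj u v → Adj (σ u) (σ v))
                (σ-fixes-none : ∀ v → σ v ≢ v)
                (σ-nonadjacent : ∀ v → ¬ Adj v (σ v)) where

    Closed : VSet n → Set
    Closed S = ∀ {u} → u ∈ S → σ u ∈ S

    σ-injective : ∀ {u v} → σ u ≡ σ v → u ≡ v
    σ-injective {u} {v} e = trans (sym (σ-involutive u)) (trans (cong σ e) (σ-involutive v))

    removeIsolated-closed : ∀ S → Closed S → Closed (removeIsolated S)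
    removeIsolated-closed S closed u∈ =
      let u∈S , x , x∈S , u~x = to (∈-removeIsolated S) u∈
      in from (∈-removeIsolated S) (closed u∈S , σ x , closed x∈S , σ-adj u~x)

    delete-pair-closed : ∀ S v → Closed S → Closed (delete (delete S v) (σ v))
    delete-pair-closed S v closed {u} u∈ =
      let u∈S′ , u≢σv = to (∈-delete (delete S v) (σ v)) u∈
          u∈S , u≢v = to (∈-delete S v) u∈S′
      in from (∈-delete (delete S v) (σ v))
           (from (∈-delete S v)
              (closed u∈S , λ σu≡v → u≢σv (trans (sym (σ-involutive u)) (cong σ σu≡v))) ,
            λ σu≡σv → u≢v (σ-injective σu≡σv))

    closed-≗ : ∀ {A B} → A ≗ B → Closed A → Closed B
    closed-≗ {A} {B} A≗B closed {u} u∈B =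
      subst T (A≗B (σ u)) (closed (subst T (sym (A≗B u)) u∈B))

    mirror-closed : ∀ {S} v → Closed S → Closed (move (move S v) (σ v))
    mirror-closed {S} v closed =
      closed-≗ (λ u → sym (move-removeIsolated (delete S v) (σ v) u))
        (removeIsolated-closed (delete (delete S v) (σ v)) (delete-pair-closed S v closed))

    σ-∈-move : ∀ {S v} → Closed S → NoIsolated S → v ∈ S → σ v ∈ move S v
    σ-∈-move {S} {v} closed noIsolated v∈S =
      let x , x∈S , σv~x = noIsolated (closed v∈S)
          x≢v : x ≢ v
          x≢v x≡v = σ-nonadjacent v (Adj-sym (subst (Adj (σ v)) x≡v σv~x))
      in from (∈-removeIsolated (delete S v))
           (from (∈-delete S v) (closed v∈S , σ-fixes-none v) ,
            x , from (∈-delete S v) (x∈S , x≢v) , σv~x)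

    mirror-PPos : ∀ {S} → Acc _⊂_ S → Closed S → NoIsolated S → PPos S
    mirror-PPos {S} (acc smaller) closed noIsolated = allMovesLose λ v v∈S →
      winningMove (σ v) (σ-∈-move closed noIsolated v∈S)
        (mirror-PPos (smaller (⊆-⊂-trans (move-⊆ (move S v) (σ v)) (move-⊂ v∈S)))
           (mirror-closed v closed)
           (removeIsolated-noIsolated (delete (move S v) (σ v))))

theorem4p2 : (n : ℕ) (G : Graph n) (σ : Permutation′ n) →
    IsAutomorphism G σ → HasOrderTwo σ →
    (∀ v → σ ⟨$⟩ʳ v ≢ v) → (∀ v → ¬ Graph.Adj G v (σ ⟨$⟩ʳ v)) →
    Grim.IsP G
theorem4p2 n G σ aut (involutive , _) fixes-none nonadjacent =
  mirror-PPos (⊂-wellFounded start)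
    (removeIsolated-closed (λ _ → true) (λ _ → _))
    (removeIsolated-noIsolated _)
  where
  open Grim G
  open GrimProperties G
  open Mirror (σ ⟨$⟩ʳ_) involutive (λ {u} {v} → to (aut u v)) fixes-none nonadjacent
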